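{- Let $S$ be a set and $R$ a binary relation on $S$, and suppose the complete lattice $\langle\wp(S)^{\blacktriangle},\subseteq\rangle$ is spatial. Then the following are equivalent: (i) $\langle\wp(S)^{\blacktriangle},\subseteq\rangle$ is completely distributive; (ii) for every $s\in S$ such that $[s]$ is a completely join-irreducible element of $\langle\wp(S)^{\blacktriangle},\subseteq\rangle$, we have $[s]\not\subseteq\bigcup\{[x]: x\in S,\ [s]\not\subseteq[x]\}$.
   Context: $Rab$ means $(a,b)\in R$. For $x\in S$, $[x]=\{y: Ryx\}$. For $A\subseteq S$, $A^{\blacktriangle}=\bigcup\{[x]: x\in A\}$, and $\wp(S)^{\blacktriangle}=\{A^{\blacktriangle}: A\subseteq S\}$ ordered by inclusion (a complete lattice with joins given by unions and least element $\emptyset$). In a complete lattice $L$, $x\neq 0$ is completely join-irreducible if whenever $\bigvee K=x$ for $K\subseteq L$ then $x\in K$; $L$ is spatial if every element is a join of completely join-irreducible elements. -}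

module Defs where

open import Level using (0ℓ) renaming (suc to lsuc)
open import Data.Product using (Σ; Σ-syntax; _×_; _,_)
open import Data.Empty using (⊥)
open import Relation.Nullary using (¬_)

Sub : Set → Set₁
Sub S = S → Set

module _ {S : Set} where

  infix 4 _⊆_ _≐_
  _⊆_ : Sub S → Sub S → Set
  X ⊆ Y = ∀ {s} → X s → Y s

  _≐_ : Sub S → Sub S → Set
  X ≐ Y = (X ⊆ Y) × (Y ⊆ X)

  ∅ : Sub S
  ∅ _ = ⊥

  -- union of an I-indexed family of subsets (the join in ℘(S)^▲)
  ⋃ : {I : Set} → (I → Sub S) → Sub S
  ⋃ {I} f s = Σ[ i ∈ I ] f i s

module _ {S : Set} (R : S → S → Set) where

  ⟦_⟧ : S → Sub S
  ⟦ x ⟧ y = R y x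

  _▲ : Sub S → Sub S
  (A ▲) y = Σ[ x ∈ S ] (A x × R y x)

  InL : Sub S → Set₁
  InL X = Σ[ A ∈ Sub S ] (X ≐ A ▲)

  CJI : Sub S → Set₁
  CJI X = ¬ (X ≐ ∅)
        × (∀ (I : Set) (f : I → Sub S) → (∀ i → InL (f i))
             → ⋃ f ≐ X → Σ[ i ∈ I ] (f i ≐ X))

  Spatial : Set₁
  Spatial = ∀ X → InL X →
    Σ[ I ∈ Set ] Σ[ f ∈ (I → Sub S) ]
      ((∀ i → InL (f i) × CJI (f i)) × (⋃ f ≐ X))

  IsMeet : {K : Set} → Sub S → (K → Sub S) → Set₁
  IsMeet {K} M g = InL M × (∀ k → M ⊆ g k)
                 × (∀ Y → InL Y → (∀ k → Y ⊆ g k) → Y ⊆ M)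

  CompletelyDistributive : Set₁
  CompletelyDistributive =
    ∀ (I : Set) (J : I → Set) (x : (i : I) → J i → Sub S)
    → (∀ i j → InL (x i j))
    → (M : Sub S) → IsMeet M (λ i → ⋃ (x i))
    → (m : ((i : I) → J i) → Sub S)
    → (∀ φ → IsMeet (m φ) (λ i → x i (φ i)))
    → M ≐ ⋃ m

  ConditionII : Set₁
  ConditionII = ∀ (s : S) → CJI ⟦ s ⟧ →
    ¬ (⟦ s ⟧ ⊆ (λ y → Σ[ x ∈ S ] (¬ (⟦ s ⟧ ⊆ ⟦ x ⟧) × R y x)))

-- Write L = ℘(S)^▲ and [z] = {y : R y z}.  Every principal set [z] lies in L
-- and every element of L is the union of the principal sets it contains;
-- consequently a completely join-irreducible element of L is principal, and
-- L has binary meets a ⊓ b = ⋃{[z] : [z] ⊆ a, [z] ⊆ b}.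
--
-- (ii) ⇒ (i): condition (ii) together with excluded middle makes every c.j.i.
-- [s] completely join-prime (below a union of L-elements ⇒ below one of them).
-- In a spatial L each point of a meet M = ⋀ᵢ ⋁ⱼ xᵢⱼ lies in a c.j.i. [s] ⊆ M;
-- choosing for every i some φ i with [s] ⊆ xᵢ(φ i) puts the point into
-- ⋀ᵢ xᵢ(φ i).  The reverse inclusion holds in every complete lattice.
--
-- (i) ⇒ (ii): complete distributivity gives a ⊆ ⋃ⱼ (a ⊓ bⱼ) whenever
-- a ⊆ ⋃ⱼ bⱼ.  Applied to a = [s] and the [x] with [s] ⊈ [x], join-irreducibility
-- of [s] yields some [s] ⊓ [x] = [s], i.e. [s] ⊆ [x], a contradiction.
module Submission where

open import Defs
open import Level using (0ℓ) renaming (suc to lsuc)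
open import Axiom.ExcludedMiddle using (ExcludedMiddle)
open import Function.Bundles using (_⇔_; mk⇔)
open import Data.Product using (Σ-syntax; _×_; _,_; proj₁; proj₂)
open import Data.Empty using (⊥-elim)
open import Data.Unit using (⊤; tt)
open import Data.Bool using (Bool; true; false)
open import Relation.Nullary using (¬_; yes; no)
open import Relation.Binary.PropositionalEquality using (_≡_; refl)

module _ {S : Set} (R : S → S → Set) where

  [_] : S → Sub S
  [ z ] = ⟦_⟧ R z

  -- Principal sets belong to L: [z] = {z}^▲.
  principal-InL : ∀ z → InL R [ z ]
  principal-InL z = (_≡ z) , (λ r → z , refl , r) , λ { (_ , refl , r) → r }

  principal-cover : ∀ {X y} → InL R X → X y → Σ[ z ∈ S ] (R y z × [ z ] ⊆ X)
  principal-cover (A , X⊆A▲ , A▲⊆X) p with X⊆A▲ p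
  ... | z , Az , r = z , r , λ r′ → A▲⊆X (z , Az , r′)

  _⊓_ : Sub S → Sub S → Sub S
  a ⊓ b = _▲ R (λ z → [ z ] ⊆ a × [ z ] ⊆ b)

  ⊓-InL : ∀ a b → InL R (a ⊓ b)
  ⊓-InL a b = _ , (λ p → p) , (λ p → p)

  ⊓-lowerˡ : ∀ {a b} → a ⊓ b ⊆ a
  ⊓-lowerˡ (_ , (za , _) , r) = za r

  ⊓-lowerʳ : ∀ {a b} → a ⊓ b ⊆ b
  ⊓-lowerʳ (_ , (_ , zb) , r) = zb r

  ⊓-greatest : ∀ {a b Y} → InL R Y → Y ⊆ a → Y ⊆ b → Y ⊆ a ⊓ b
  ⊓-greatest inY Ya Yb p with principal-cover inY p
  ... | z , r , zY = z , ((λ q → Ya (zY q)) , (λ q → Yb (zY q))) , r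

  CJI-resp-≐ : ∀ {X Y} → CJI R X → X ≐ Y → CJI R Y
  CJI-resp-≐ (X≢∅ , irr) (X⊆Y , Y⊆X) =
      (λ { (Y⊆∅ , _) → X≢∅ ((λ p → Y⊆∅ (X⊆Y p)) , λ ()) })
    , λ I f inf (⋃f⊆Y , Y⊆⋃f) →
        let (i , fi⊆X , X⊆fi) = irr I f inf ((λ p → Y⊆X (⋃f⊆Y p)) , λ p → Y⊆⋃f (X⊆Y p))
        in i , (λ p → X⊆Y (fi⊆X p)) , λ p → X⊆fi (Y⊆X p)

  -- A c.j.i. element of L is principal: it is the union of the principal
  -- sets it contains, so by irreducibility it equals one of them.
  CJI-principal : ∀ {X} → InL R X → CJI R X → Σ[ z ∈ S ] ([ z ] ≐ X)
  CJI-principal {X} inX (_ , irr)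
    with irr (Σ[ z ∈ S ] ([ z ] ⊆ X)) (λ b → [ proj₁ b ]) (λ b → principal-InL (proj₁ b))
             ( (λ { ((_ , zX) , r) → zX r })
             , (λ p → let (z , r , zX) = principal-cover inX p in (z , zX) , r) )
  ... | (z , _) , z≐X = z , z≐X

  spatial-cover : Spatial R → ∀ {X y} → InL R X → X y
                → Σ[ s ∈ S ] (CJI R [ s ] × [ s ] ⊆ X × R y s)
  spatial-cover sp inX p with sp _ inX
  ... | K , f , f-cji , (⋃f⊆X , X⊆⋃f) with X⊆⋃f p
  ... | k , fk-p with CJI-principal (proj₁ (f-cji k)) (proj₂ (f-cji k))
  ... | s , (s⊆fk , fk⊆s) =
    s , CJI-resp-≐ (proj₂ (f-cji k)) (fk⊆s , s⊆fk) , (λ q → ⋃f⊆X (k , s⊆fk q)) , fk⊆s fk-p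

  -- Under condition (ii), every c.j.i. principal set is completely join-prime:
  -- otherwise each point of [s] would lie in some [z] with [s] ⊈ [z].
  conditionII⇒join-prime : ExcludedMiddle 0ℓ → ConditionII R → ∀ s → CJI R [ s ]
    → {I : Set} (g : I → Sub S) → (∀ i → InL R (g i))
    → [ s ] ⊆ ⋃ g → Σ[ i ∈ I ] ([ s ] ⊆ g i)
  conditionII⇒join-prime em condII s cji {I} g ing s⊆⋃g with em {Σ[ i ∈ I ] ([ s ] ⊆ g i)}
  ... | yes below = below
  ... | no ¬below = ⊥-elim (condII s cji covered)
    where
    covered : [ s ] ⊆ (λ y → Σ[ x ∈ S ] (¬ ([ s ] ⊆ [ x ]) × R y x))
    covered q with s⊆⋃g q
    ... | i , gi-y with principal-cover (ing i) gi-y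
    ... | z , r , z⊆gi = z , (λ s⊆z → ¬below (i , λ q′ → z⊆gi (s⊆z q′))) , r

  choice-joins-below-meet : ∀ {I : Set} {J : I → Set} {x : (i : I) → J i → Sub S}
    → {M : Sub S} → IsMeet R M (λ i → ⋃ (x i))
    → {m : ((i : I) → J i) → Sub S} → (∀ φ → IsMeet R (m φ) (λ i → x i (φ i)))
    → ⋃ m ⊆ M
  choice-joins-below-meet (_ , _ , M-greatest) m-meet (φ , p)
    with m-meet φ
  ... | inmφ , mφ-lower , _ with principal-cover inmφ p
  ... | z , r , z⊆mφ =
    M-greatest [ z ] (principal-InL z) (λ i q → φ i , mφ-lower i (z⊆mφ q)) r

  conditionII⇒distributive : ExcludedMiddle 0ℓ → Spatial R → ConditionII R
                           → CompletelyDistributive R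
  conditionII⇒distributive em sp condII I J x inx M M-meet m m-meet =
    M⊆⋃m , choice-joins-below-meet M-meet m-meet
    where
    M⊆⋃m : M ⊆ ⋃ m
    M⊆⋃m p with spatial-cover sp (proj₁ M-meet) p
    ... | s , cji , s⊆M , r = φ , m-greatest [ s ] (principal-InL s) (λ i → proj₂ (choose i)) r
      where
      choose : ∀ i → Σ[ j ∈ J i ] ([ s ] ⊆ x i j)
      choose i = conditionII⇒join-prime em condII s cji (x i) (inx i)
                   (λ q → proj₁ (proj₂ M-meet) i (s⊆M q))
      φ : (i : I) → J i
      φ i = proj₁ (choose i)
      m-greatest : ∀ Y → InL R Y → (∀ i → Y ⊆ x i (φ i)) → Y ⊆ m φ
      m-greatest = proj₂ (proj₂ (m-meet φ))

  -- Complete distributivity yields a ⊆ ⋃ⱼ (a ⊓ bⱼ) whenever a ⊆ ⋃ⱼ bⱼ: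
  -- apply it to the two-row family (a ; bⱼ), whose meet of joins is a.
  distributive⇒meet-distributes : CompletelyDistributive R
    → ∀ {a} {J : Set} {b : J → Sub S} → InL R a → (∀ j → InL R (b j))
    → a ⊆ ⋃ b → a ⊆ ⋃ (λ j → a ⊓ b j)
  distributive⇒meet-distributes cd {a} {J} {b} ina inb a⊆⋃b p
    with proj₁ (cd Bool row x inx a a-meet (λ φ → a ⊓ b (φ false)) choice-meet) p
    where
    row : Bool → Set
    row true = ⊤
    row false = J
    x : (i : Bool) → row i → Sub S
    x true _ = a
    x false j = b j
    inx : ∀ i j → InL R (x i j)
    inx true _ = ina
    inx false j = inb j
    a-meet : IsMeet R a (λ i → ⋃ (x i))
    a-meet = ina , (λ { true q → tt , q ; false q → a⊆⋃b q }) , λ Y _ below q → proj₂ (below true q)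
    choice-meet : ∀ φ → IsMeet R (a ⊓ b (φ false)) (λ i → x i (φ i))
    choice-meet φ = ⊓-InL _ _
                  , (λ { true → ⊓-lowerˡ ; false → ⊓-lowerʳ })
                  , λ Y inY below → ⊓-greatest inY (below true) (below false)
  ... | φ , q = φ false , q

  distributive⇒conditionII : CompletelyDistributive R → ConditionII R
  distributive⇒conditionII cd s (_ , irr) s⊆⋃ = s⊈x (λ q → ⊓-lowerʳ (s⊆s⊓x q))
    where
    N : Set
    N = Σ[ x ∈ S ] (¬ ([ s ] ⊆ [ x ]))
    split : Σ[ n ∈ N ] ([ s ] ⊓ [ proj₁ n ] ≐ [ s ])
    split = irr N (λ n → [ s ] ⊓ [ proj₁ n ]) (λ n → ⊓-InL _ _)
              ( (λ { (_ , q) → ⊓-lowerˡ q })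
              , distributive⇒meet-distributes cd (principal-InL s)
                  (λ n → principal-InL (proj₁ n))
                  (λ q → let (x , s⊈x , r) = s⊆⋃ q in (x , s⊈x) , r) )
    s⊈x : ¬ ([ s ] ⊆ [ proj₁ (proj₁ split) ])
    s⊈x = proj₂ (proj₁ split)
    s⊆s⊓x : [ s ] ⊆ [ s ] ⊓ [ proj₁ (proj₁ split) ]
    s⊆s⊓x = proj₂ (proj₂ split)

mainTheorem12 : ExcludedMiddle 0ℓ → ExcludedMiddle (lsuc 0ℓ) →
    (S : Set) (R : S → S → Set) → Spatial R →
    (CompletelyDistributive R ⇔ ConditionII R)
mainTheorem12 em _ S R sp =
  mk⇔ (distributive⇒conditionII R) (conditionII⇒distributive R em sp)
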